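{- Let $n\ge 8$, $D=(\mathcal V,\mathcal A)\in EX(n)$ with maximum out-degree $\Delta^+$, and $v\in\mathcal V$ with $d^+(v)=\Delta^+$. Put $\mathcal V_1=N^+(v)$, $\mathcal V_2=\mathcal V\setminus\mathcal V_1$, $\mathcal V_3=\{u\in\mathcal V_2: N^+(u)=\mathcal V_1\}$, $\mathcal V_4=\mathcal V_2\setminus\mathcal V_3$. If $u_1,u_2\in\mathcal V_2$ and $u_1\to u_2$ is an arc, then there is no arc from a vertex of $N^+(u_1)\cap\mathcal V_1$ to a vertex of $N^+(u_2)\cap\mathcal V_1$. Moreover, if in addition every vertex of $\mathcal V_1$ has exactly one in-neighbour in $\mathcal V_1$ and $d^+(u_1)=d^+(u_2)=\Delta^+$, then $u_1$ has exactly $\Delta^+-1$ out-neighbours in $\mathcal V_1$, and, denoting by $u_1'$ the unique vertex of $\mathcal V_1\setminus N^+(u_1)$, we have: $u_1'\to t$ for every $t\in N^+(u_2)\cap\mathcal V_1$, $u_2\in\mathcal V_4$, and $N^+(u_2)\cap\mathcal V_1=\mathcal V_1\setminus\{u_1'\}$.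
   Context: Digraphs are strict (no loops, no parallel arcs). $N^+(u)$ is the out-neighbourhood of $u$ and $d^+(u)=|N^+(u)|$. A digraph is $\mathscr{F}$-free if it does not contain two distinct walks of length 2 (sequences $u\to a\to w$ of arcs, $u=w$ allowed) with the same initial and terminal vertices. $ex(n)$ is the maximum number of arcs of an $\mathscr{F}$-free digraph on $n$ vertices, and $EX(n)$ is the set of $\mathscr{F}$-free digraphs on $n$ vertices with exactly $ex(n)$ arcs. -}

module Defs where

open import Data.Nat using (ℕ; _+_; _≤_; _⊔_)
open import Data.Fin using (Fin)
open import Data.Fin.Subset using (Subset; _∈_; _∉_; ∣_∣; _∩_; ∁)
open import Data.Vec using (tabulate; lookup; foldr; map)
open import Data.Product using (_×_)
open import Relation.Binary.PropositionalEquality using (_≡_)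
open import Relation.Nullary using (¬_)

-- Parallel arcs are impossible
-- in this representation; strictness (no loops) is a separate predicate.
Digraph : ℕ → Set
Digraph n = Fin n → Subset n

module _ {n : ℕ} (D : Digraph n) where

  N⁺ : Fin n → Subset n
  N⁺ u = D u

  Arc : Fin n → Fin n → Set
  Arc u w = w ∈ D u

  d⁺ : Fin n → ℕ
  d⁺ u = ∣ D u ∣

  N⁻ : Fin n → Subset n
  N⁻ x = tabulate (λ y → lookup (D y) x)

  Loopless : Set
  Loopless = ∀ u → ¬ Arc u u

  arcs : ℕ
  arcs = foldr _ _+_ 0 (tabulate d⁺)

  Δ⁺ : ℕ
  Δ⁺ = foldr _ _⊔_ 0 (tabulate d⁺)

  -- F-free: no two distinct walks u → a → w, u → b → w (u = w allowed)
  FFree : Set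
  FFree = ∀ u a b w → Arc u a → Arc a w → Arc u b → Arc b w → a ≡ b

InEX : (n : ℕ) → Digraph n → Set
InEX n D = Loopless D × FFree D
         × (∀ (D' : Digraph n) → Loopless D' → FFree D' → arcs D' ≤ arcs D)

module Submission where

-- Write Δ for the maximum out-degree and call Δ − d⁺ y the deficit of y. In an F-free
-- digraph the walks of length two leaving w end in distinct vertices, so the out-degrees
-- of the out-neighbours of w sum to at most n; for d⁺ w = Δ this bounds the number of arcs
-- plus the total deficit of the vertices missed by w by n + (n − Δ)Δ. Explicit F-free
-- digraphs with (1 + c)(1 + a) + (1 + c + a) arcs on 2 + c + a vertices bound ex(n) from
-- below, so that total deficit is at most a slack σ with σ ≤ 1, 2 + σ < Δ and n + 2σ < 3Δ
-- (this is where n ≥ 8 enters). In particular three out-neighbours of any vertex have total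
-- deficit above 2σ.
--
-- The first part is F-freeness alone: an arc a → b gives the walks u₁ → a → b and
-- u₁ → u₂ → b. The second rests on one claim: if every vertex of V₁ has a unique
-- in-neighbour in V₁, a vertex u with d⁺ u = Δ has at most one out-neighbour outside V₁.
-- Given two, the deficit bounds put every out-neighbour of u in V₁ into the out-neighbourhood
-- of every vertex of out-degree Δ, and provide such an out-neighbour h. Then two vertices
-- m ≠ m′ of V₁ missed by u cannot both have out-degree Δ (walks v → m → h, v → m′ → h);
-- and if d⁺ m < Δ, then d⁺ m′ = Δ and N⁺ m consists of at most one vertex of out-degree Δ
-- and at most one deficient vertex outside V₁, against d⁺ m > 2. With the claim,
-- counting gives ∣N⁺ u₁ ∩ V₁∣ = Δ − 1, and every t ∈ N⁺ u₂ ∩ V₁ has its in-neighbour in V₁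
-- outside N⁺ u₁ by the first part, hence equal to the one vertex u₁′ of V₁ ∖ N⁺ u₁.

open import Defs
open import Data.Bool using (Bool; T)
open import Data.Bool.Properties using (T-≡)
open import Data.Empty using (⊥; ⊥-elim)
open import Data.Fin using (Fin; zero; suc; toℕ; fromℕ<)
open import Data.Fin.Properties using (_≟_; suc-injective; toℕ-injective; toℕ-fromℕ<)
open import Data.Fin.Subset
  using (Subset; inside; outside; _∈_; _∉_; ∣_∣; _∩_; _∪_; ∁; _─_; _-_; ⁅_⁆; _⊆_; ⊤; Nonempty)
  renaming (⊥ to ∅)
open import Data.Fin.Subset.Properties
open import Data.Nat using (ℕ; zero; suc; _+_; _*_; _∸_; _⊔_; _⊓_; pred; _<ᵇ_; _≤_; _<_; z≤n; s≤s; s≤s⁻¹)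
open import Data.Nat.Properties hiding (_≟_; suc-injective)
open import Data.Nat.Properties using () renaming (_≟_ to _≟ℕ_)
open import Data.Nat.Tactic.RingSolver using (solve-∀)
open import Data.Product using (_×_; _,_; Σ; ∃; proj₁; proj₂)
open import Data.Sum using (_⊎_; inj₁; inj₂) renaming (map to ⊎-map)
open import Data.Vec using ([]; _∷_; here; there; tabulate; foldr; lookup)
open import Data.Vec.Properties using (lookup∘tabulate; []=⇒lookup; lookup⇒[]=)
open import Function using (_∘_)
open import Function.Bundles using (_⇔_; mk⇔; Equivalence)
open import Relation.Binary.Definitions using (tri<; tri≈; tri>)
open import Relation.Binary.PropositionalEquality
open import Relation.Nullary
  using (¬_; contradiction; yes; no; Dec; ⌊_⌋; toWitness; fromWitness; map′; _×-dec_)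
open import Algebra.Properties.CommutativeSemigroup +-commutativeSemigroup
  using (x∙yz≈y∙xz; xy∙z≈y∙xz) renaming (interchange to +-interchange)

private variable
  n m : ℕ

sumOver : Subset n → (Fin n → ℕ) → ℕ
sumOver []            f = 0
sumOver (inside  ∷ p) f = f zero + sumOver p (f ∘ suc)
sumOver (outside ∷ p) f = sumOver p (f ∘ suc)

syntax sumOver p (λ x → e) = ∑[ x ∈ p ] e

sumOver-mono-≤ : ∀ (p : Subset n) {f g : Fin n → ℕ} →
                 (∀ {x} → x ∈ p → f x ≤ g x) → ∑[ x ∈ p ] f x ≤ ∑[ x ∈ p ] g x
sumOver-mono-≤ []            f≤g = z≤n
sumOver-mono-≤ (inside  ∷ p) f≤g = +-mono-≤ (f≤g here) (sumOver-mono-≤ p (f≤g ∘ there))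
sumOver-mono-≤ (outside ∷ p) f≤g = sumOver-mono-≤ p (f≤g ∘ there)

sumOver-cong : ∀ (p : Subset n) {f g : Fin n → ℕ} →
               (∀ {x} → x ∈ p → f x ≡ g x) → ∑[ x ∈ p ] f x ≡ ∑[ x ∈ p ] g x
sumOver-cong []            f≡g = refl
sumOver-cong (inside  ∷ p) f≡g = cong₂ _+_ (f≡g here) (sumOver-cong p (f≡g ∘ there))
sumOver-cong (outside ∷ p) f≡g = sumOver-cong p (f≡g ∘ there)

sumOver-+ : ∀ (p : Subset n) (f g : Fin n → ℕ) →
            ∑[ x ∈ p ] (f x + g x) ≡ ∑[ x ∈ p ] f x + ∑[ x ∈ p ] g x
sumOver-+ []            f g = refl
sumOver-+ (inside  ∷ p) f g = begin
  f zero + g zero + sumOver p (λ x → f (suc x) + g (suc x))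
    ≡⟨ cong (f zero + g zero +_) (sumOver-+ p (f ∘ suc) (g ∘ suc)) ⟩
  f zero + g zero + (sumOver p (f ∘ suc) + sumOver p (g ∘ suc))
    ≡⟨ +-interchange (f zero) (g zero) _ _ ⟩
  f zero + sumOver p (f ∘ suc) + (g zero + sumOver p (g ∘ suc)) ∎
  where open ≡-Reasoning
sumOver-+ (outside ∷ p) f g = sumOver-+ p (f ∘ suc) (g ∘ suc)

sumOver-const : ∀ (p : Subset n) k → ∑[ x ∈ p ] k ≡ ∣ p ∣ * k
sumOver-const []            k = refl
sumOver-const (inside  ∷ p) k = cong (k +_) (sumOver-const p k)
sumOver-const (outside ∷ p) k = sumOver-const p k

∣p∣*k≤sumOver : ∀ (p : Subset n) {f : Fin n → ℕ} k → (∀ {x} → x ∈ p → k ≤ f x) → ∣ p ∣ * k ≤ ∑[ x ∈ p ] f x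
∣p∣*k≤sumOver p k k≤f = subst (_≤ _) (sumOver-const p k) (sumOver-mono-≤ p k≤f)

sumOver-split : ∀ (p q : Subset n) (f : Fin n → ℕ) →
                ∑[ x ∈ p ] f x ≡ ∑[ x ∈ p ∩ q ] f x + ∑[ x ∈ p ∩ ∁ q ] f x
sumOver-split []            []            f = refl
sumOver-split (inside  ∷ p) (inside  ∷ q) f = trans (cong (f zero +_) (sumOver-split p q (f ∘ suc)))
                                                    (sym (+-assoc (f zero) _ _))
sumOver-split (inside  ∷ p) (outside ∷ q) f = trans (cong (f zero +_) (sumOver-split p q (f ∘ suc)))
                                                    (x∙yz≈y∙xz (f zero) (sumOver (p ∩ q) (f ∘ suc)) _)
sumOver-split (outside ∷ p) (_       ∷ q) f = sumOver-split p q (f ∘ suc)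

sumOver-remove : ∀ {p : Subset n} {x} (f : Fin n → ℕ) → x ∈ p →
                 ∑[ y ∈ p ] f y ≡ f x + ∑[ y ∈ p - x ] f y
sumOver-remove {p = inside  ∷ p} f here = cong (λ r → f zero + sumOver r (f ∘ suc)) (sym (p─⊥≡p p))
sumOver-remove {p = inside  ∷ p} {suc x} f (there x∈p) =
  trans (cong (f zero +_) (sumOver-remove (f ∘ suc) x∈p)) (x∙yz≈y∙xz (f zero) (f (suc x)) _)
sumOver-remove {p = outside ∷ p} f (there x∈p) = sumOver-remove (f ∘ suc) x∈p

sumOver-⊤ : ∀ (q : Subset n) (f : Fin n → ℕ) → ∑[ x ∈ ⊤ ] f x ≡ ∑[ x ∈ q ] f x + ∑[ x ∈ ∁ q ] f x
sumOver-⊤ q f = trans (sumOver-split ⊤ q f)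
                      (cong₂ (λ p p′ → sumOver p f + sumOver p′ f) (∩-identityˡ q) (∩-identityˡ (∁ q)))

sumOver-≥₁ : ∀ {p : Subset n} {x} (f : Fin n → ℕ) → x ∈ p → f x ≤ ∑[ y ∈ p ] f y
sumOver-≥₁ f x∈p = ≤-trans (m≤m+n (f _) _) (≤-reflexive (sym (sumOver-remove f x∈p)))

sumOver-≥₂ : ∀ {p : Subset n} {x y} (f : Fin n → ℕ) → x ∈ p → y ∈ p → x ≢ y →
             f x + f y ≤ ∑[ z ∈ p ] f z
sumOver-≥₂ f x∈p y∈p x≢y = ≤-trans (+-monoʳ-≤ (f _) (sumOver-≥₁ f (x∈p∧x≢y⇒x∈p-y y∈p (x≢y ∘ sym))))
                                   (≤-reflexive (sym (sumOver-remove f x∈p)))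

sumOver-≥₃ : ∀ {p : Subset n} {x y z} (f : Fin n → ℕ) → x ∈ p → y ∈ p → z ∈ p →
             x ≢ y → x ≢ z → y ≢ z → f x + f y + f z ≤ ∑[ w ∈ p ] f w
sumOver-≥₃ {p = p} {x} f x∈p y∈p z∈p x≢y x≢z y≢z = begin
  f x + f _ + f _           ≡⟨ +-assoc (f x) _ _ ⟩
  f x + (f _ + f _)         ≤⟨ +-monoʳ-≤ (f x) (sumOver-≥₂ f (x∈p∧x≢y⇒x∈p-y y∈p (x≢y ∘ sym))
                                                          (x∈p∧x≢y⇒x∈p-y z∈p (x≢z ∘ sym)) y≢z) ⟩
  f x + ∑[ w ∈ p - x ] f w  ≡⟨ sumOver-remove f x∈p ⟨
  ∑[ w ∈ p ] f w            ∎
  where open ≤-Reasoning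

∣p∣≡∑1 : ∀ (p : Subset n) → ∣ p ∣ ≡ ∑[ x ∈ p ] 1
∣p∣≡∑1 p = sym (trans (sumOver-const p 1) (*-identityʳ ∣ p ∣))

∣p∣≡∣p∩q∣+∣p∩∁q∣ : ∀ (p q : Subset n) → ∣ p ∣ ≡ ∣ p ∩ q ∣ + ∣ p ∩ ∁ q ∣
∣p∣≡∣p∩q∣+∣p∩∁q∣ p q = begin
  ∣ p ∣                                   ≡⟨ ∣p∣≡∑1 p ⟩
  ∑[ x ∈ p ] 1                            ≡⟨ sumOver-split p q _ ⟩
  ∑[ x ∈ p ∩ q ] 1 + ∑[ x ∈ p ∩ ∁ q ] 1   ≡⟨ cong₂ _+_ (∣p∣≡∑1 (p ∩ q)) (∣p∣≡∑1 (p ∩ ∁ q)) ⟨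
  ∣ p ∩ q ∣ + ∣ p ∩ ∁ q ∣                 ∎
  where open ≡-Reasoning

∣p∩∁q∣≡∣q∩∁p∣ : ∀ (p q : Subset n) → ∣ p ∣ ≡ ∣ q ∣ → ∣ p ∩ ∁ q ∣ ≡ ∣ q ∩ ∁ p ∣
∣p∩∁q∣≡∣q∩∁p∣ p q ∣p∣≡∣q∣ = +-cancelˡ-≡ ∣ p ∩ q ∣ _ _ (begin
  ∣ p ∩ q ∣ + ∣ p ∩ ∁ q ∣  ≡⟨ ∣p∣≡∣p∩q∣+∣p∩∁q∣ p q ⟨
  ∣ p ∣                    ≡⟨ ∣p∣≡∣q∣ ⟩
  ∣ q ∣                    ≡⟨ ∣p∣≡∣p∩q∣+∣p∩∁q∣ q p ⟩
  ∣ q ∩ p ∣ + ∣ q ∩ ∁ p ∣  ≡⟨ cong (λ r → ∣ r ∣ + ∣ q ∩ ∁ p ∣) (∩-comm q p) ⟩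
  ∣ p ∩ q ∣ + ∣ q ∩ ∁ p ∣  ∎)
  where open ≡-Reasoning

∣p∪q∣≡∣p∣+∣q∣ : ∀ {p q : Subset n} → (∀ {x} → x ∈ p → x ∉ q) → ∣ p ∪ q ∣ ≡ ∣ p ∣ + ∣ q ∣
∣p∪q∣≡∣p∣+∣q∣ {p = []}          {[]}          _        = refl
∣p∪q∣≡∣p∣+∣q∣ {p = inside  ∷ p} {inside  ∷ q} disjoint = ⊥-elim (disjoint here here)
∣p∪q∣≡∣p∣+∣q∣ {p = inside  ∷ p} {outside ∷ q} disjoint =
  cong suc (∣p∪q∣≡∣p∣+∣q∣ λ x∈p x∈q → disjoint (there x∈p) (there x∈q))
∣p∪q∣≡∣p∣+∣q∣ {p = outside ∷ p} {inside  ∷ q} disjoint =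
  trans (cong suc (∣p∪q∣≡∣p∣+∣q∣ λ x∈p x∈q → disjoint (there x∈p) (there x∈q))) (sym (+-suc _ _))
∣p∪q∣≡∣p∣+∣q∣ {p = outside ∷ p} {outside ∷ q} disjoint =
  ∣p∪q∣≡∣p∣+∣q∣ λ x∈p x∈q → disjoint (there x∈p) (there x∈q)

∣p∣≤1+∣p-x∣ : ∀ (p : Subset n) x → ∣ p ∣ ≤ suc ∣ p - x ∣
∣p∣≤1+∣p-x∣ (inside  ∷ p) zero    = s≤s (≤-reflexive (cong ∣_∣ (sym (p─⊥≡p p))))
∣p∣≤1+∣p-x∣ (outside ∷ p) zero    = m≤n⇒m≤1+n (≤-reflexive (cong ∣_∣ (sym (p─⊥≡p p))))
∣p∣≤1+∣p-x∣ (inside  ∷ p) (suc x) = s≤s (∣p∣≤1+∣p-x∣ p x)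
∣p∣≤1+∣p-x∣ (outside ∷ p) (suc x) = ∣p∣≤1+∣p-x∣ p x

x∈p─q⇒x∉q : ∀ {p q : Subset n} {x} → x ∈ p ─ q → x ∉ q
x∈p─q⇒x∉q {p = inside ∷ p} {outside ∷ q} here        ()
x∈p─q⇒x∉q {p = _      ∷ p} {_       ∷ q} (there x∈) (there x∈q) = x∈p─q⇒x∉q x∈ x∈q

x∈p-y⇒x≢y : ∀ {p : Subset n} {x y} → x ∈ p - y → x ≢ y
x∈p-y⇒x≢y x∈p-x refl = x∈p─q⇒x∉q x∈p-x (x∈⁅x⁆ _)

∣p∣>0⇒nonempty : ∀ {p : Subset n} → 0 < ∣ p ∣ → Nonempty p
∣p∣>0⇒nonempty {n} {p} 0<∣p∣ with nonempty? p
... | yes ne = ne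
... | no  ¬ne = ⊥-elim (<⇒≢ 0<∣p∣ (sym (trans (cong ∣_∣ (Empty-unique ¬ne)) (∣⊥∣≡0 n))))

∃-∈-≢ : ∀ {p : Subset n} → 1 < ∣ p ∣ → ∀ x → ∃ λ y → y ∈ p × y ≢ x
∃-∈-≢ {p = p} 1<∣p∣ x with ∣p∣>0⇒nonempty (s≤s⁻¹ (≤-trans 1<∣p∣ (∣p∣≤1+∣p-x∣ p x)))
... | y , y∈p-x = y , p─q⊆p p ⁅ x ⁆ y∈p-x , x∈p-y⇒x≢y y∈p-x

x∈p⇒0<∣p∣ : ∀ {p : Subset n} {x} → x ∈ p → 0 < ∣ p ∣
x∈p⇒0<∣p∣ x∈p = ≤-trans (s≤s z≤n) (x∈p⇒∣p-x∣<∣p∣ x∈p)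

x≢y⇒2≤∣p∣ : ∀ {p : Subset n} {x y} → x ∈ p → y ∈ p → x ≢ y → 2 ≤ ∣ p ∣
x≢y⇒2≤∣p∣ x∈p y∈p x≢y = ≤-trans (s≤s (x∈p⇒0<∣p∣ (x∈p∧x≢y⇒x∈p-y y∈p (x≢y ∘ sym)))) (x∈p⇒∣p-x∣<∣p∣ x∈p)

∃-distinct-pair : ∀ {p : Subset n} → 1 < ∣ p ∣ → ∃ λ x → ∃ λ y → x ∈ p × y ∈ p × x ≢ y
∃-distinct-pair 1<∣p∣ with x , x∈p ← ∣p∣>0⇒nonempty (≤-trans (s≤s z≤n) 1<∣p∣)
                     with y , y∈p , y≢x ← ∃-∈-≢ 1<∣p∣ x
  = x , y , x∈p , y∈p , y≢x ∘ sym

∃-distinct-triple : ∀ {p : Subset n} → 2 < ∣ p ∣ →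
                    ∃ λ x → ∃ λ y → ∃ λ z → (x ∈ p × y ∈ p × z ∈ p) × (x ≢ y × x ≢ z × y ≢ z)
∃-distinct-triple {p = p} 2<∣p∣
  with x , y , x∈p , y∈p , x≢y ← ∃-distinct-pair (≤-trans (s≤s (s≤s z≤n)) 2<∣p∣)
  with z , z∈p-x , z≢y ← ∃-∈-≢ (s≤s⁻¹ (≤-trans 2<∣p∣ (∣p∣≤1+∣p-x∣ p x))) y
  = x , y , z , (x∈p , y∈p , p─q⊆p p ⁅ x ⁆ z∈p-x) , (x≢y , x∈p-y⇒x≢y z∈p-x ∘ sym , z≢y ∘ sym)

∣p∣≤1⇒≡ : ∀ {p : Subset n} → ∣ p ∣ ≤ 1 → ∀ {x y} → x ∈ p → y ∈ p → x ≡ y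
∣p∣≤1⇒≡ ∣p∣≤1 {x} {y} x∈p y∈p with x ≟ y
... | yes x≡y = x≡y
... | no  x≢y = ⊥-elim (<⇒≱ (x≢y⇒2≤∣p∣ x∈p y∈p x≢y) ∣p∣≤1)

≡⇒∣p∣≤1 : ∀ {p : Subset n} → (∀ {x y} → x ∈ p → y ∈ p → x ≡ y) → ∣ p ∣ ≤ 1
≡⇒∣p∣≤1 {p = p} all-equal with ∣ p ∣ ≤? 1
... | yes ∣p∣≤1 = ∣p∣≤1
... | no  ∣p∣≰1 with _ , _ , x∈p , y∈p , x≢y ← ∃-distinct-pair (≰⇒> ∣p∣≰1) = ⊥-elim (x≢y (all-equal x∈p y∈p))

∣p∣≤2 : ∀ {p : Subset n} {P Q : Fin n → Set} →
        (∀ {x} → x ∈ p → P x ⊎ Q x) →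
        (∀ {x y} → x ∈ p → y ∈ p → P x → P y → x ≡ y) →
        (∀ {x y} → x ∈ p → y ∈ p → Q x → Q y → x ≡ y) → ∣ p ∣ ≤ 2
∣p∣≤2 {p = p} classify P-unique Q-unique with ∣ p ∣ ≤? 2
... | yes ∣p∣≤2 = ∣p∣≤2
... | no  ∣p∣≰2 with _ , _ , _ , (x∈p , y∈p , z∈p) , (x≢y , x≢z , y≢z) ← ∃-distinct-triple (≰⇒> ∣p∣≰2)
                with classify x∈p | classify y∈p | classify z∈p
... | inj₁ Px | inj₁ Py | _       = ⊥-elim (x≢y (P-unique x∈p y∈p Px Py))
... | inj₁ Px | inj₂ _  | inj₁ Pz = ⊥-elim (x≢z (P-unique x∈p z∈p Px Pz))
... | inj₁ _  | inj₂ Qy | inj₂ Qz = ⊥-elim (y≢z (Q-unique y∈p z∈p Qy Qz))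
... | inj₂ Qx | inj₂ Qy | _       = ⊥-elim (x≢y (Q-unique x∈p y∈p Qx Qy))
... | inj₂ Qx | inj₁ _  | inj₂ Qz = ⊥-elim (x≢z (Q-unique x∈p z∈p Qx Qz))
... | inj₂ _  | inj₁ Py | inj₁ Pz = ⊥-elim (y≢z (P-unique y∈p z∈p Py Pz))

p⊆q∧∣q∣≤∣p∣⇒p≡q : ∀ {p q : Subset n} → p ⊆ q → ∣ q ∣ ≤ ∣ p ∣ → p ≡ q
p⊆q∧∣q∣≤∣p∣⇒p≡q {p = p} p⊆q ∣q∣≤∣p∣ = ⊆-antisym p⊆q q⊆p
  where
  q⊆p : _ ⊆ p
  q⊆p {x} x∈q with x ∈? p
  ... | yes x∈p = x∈p
  ... | no  x∉p = ⊥-elim (<⇒≱ (p⊂q⇒∣p∣<∣q∣ (p⊆q , x , x∈q , x∉p)) ∣q∣≤∣p∣)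

sumOver-disjoint-≤ : ∀ (p : Subset n) (A : Fin n → Subset m) →
                     (∀ {x y z} → x ∈ p → y ∈ p → z ∈ A x → z ∈ A y → x ≡ y) →
                     ∑[ x ∈ p ] ∣ A x ∣ ≤ m
sumOver-disjoint-≤ {m = m} p A disjoint =
  m+n≤o⇒m≤o _ (with-rest p A ∅ disjoint (λ _ _ → ∉⊥))
  where
  with-rest : ∀ {k} (p : Subset k) (A : Fin k → Subset m) (B : Subset m) →
              (∀ {x y z} → x ∈ p → y ∈ p → z ∈ A x → z ∈ A y → x ≡ y) →
              (∀ {x z} → x ∈ p → z ∈ A x → z ∉ B) →
              ∑[ x ∈ p ] ∣ A x ∣ + ∣ B ∣ ≤ m
  with-rest []            A B _        _      = ∣p∣≤n B
  with-rest (outside ∷ p) A B disjoint away-B =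
    with-rest p (A ∘ suc) B (λ x∈p y∈p z∈ z∈′ → suc-injective (disjoint (there x∈p) (there y∈p) z∈ z∈′))
              (away-B ∘ there)
  with-rest (inside  ∷ p) A B disjoint away-B = begin
    ∣ A zero ∣ + S + ∣ B ∣     ≡⟨ xy∙z≈y∙xz (∣ A zero ∣) S (∣ B ∣) ⟩
    S + (∣ A zero ∣ + ∣ B ∣)   ≡⟨ cong (S +_) (∣p∪q∣≡∣p∣+∣q∣ (away-B here)) ⟨
    S + ∣ A zero ∪ B ∣         ≤⟨ with-rest p (A ∘ suc) (A zero ∪ B) disjoint′ away-A₀∪B ⟩
    m                          ∎
    where
    open ≤-Reasoning
    S = ∑[ x ∈ p ] ∣ A (suc x) ∣
    disjoint′ : ∀ {x y z} → x ∈ p → y ∈ p → z ∈ A (suc x) → z ∈ A (suc y) → x ≡ y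
    disjoint′ x∈p y∈p z∈ z∈′ = suc-injective (disjoint (there x∈p) (there y∈p) z∈ z∈′)
    away-A₀∪B : ∀ {x z} → x ∈ p → z ∈ A (suc x) → z ∉ A zero ∪ B
    away-A₀∪B x∈p z∈ z∈A₀∪B with x∈p∪q⁻ (A zero) B z∈A₀∪B
    ... | inj₁ z∈A₀ with () ← disjoint (there x∈p) here z∈ z∈A₀
    ... | inj₂ z∈B  = away-B (there x∈p) z∈ z∈B

∈-tabulate : ∀ (f : Fin n → Bool) {x} → x ∈ tabulate f ⇔ T (f x)
∈-tabulate f {x} = mk⇔
  (λ x∈ → Equivalence.from T-≡ (trans (sym (lookup∘tabulate f x)) ([]=⇒lookup x∈)))
  (λ t → lookup⇒[]= x (tabulate f) (trans (lookup∘tabulate f x) (Equivalence.to T-≡ t)))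

∣tabulate-<ᵇ∣ : ∀ n k → ∣ tabulate {n = n} (λ x → toℕ x <ᵇ k) ∣ ≡ k ⊓ n
∣tabulate-<ᵇ∣ zero    k       = sym (⊓-zeroʳ k)
∣tabulate-<ᵇ∣ (suc n) zero    = ∣tabulate-<ᵇ∣ n zero
∣tabulate-<ᵇ∣ (suc n) (suc k) = cong suc (∣tabulate-<ᵇ∣ n k)

x∈p⇒∣p∣≡1+∣p-x∣ : ∀ {p : Subset n} {x} → x ∈ p → ∣ p ∣ ≡ suc ∣ p - x ∣
x∈p⇒∣p∣≡1+∣p-x∣ {p = p} {x} x∈p = ≤-antisym (∣p∣≤1+∣p-x∣ p x) (x∈p⇒∣p-x∣<∣p∣ x∈p)

foldr-+-tabulate : ∀ (f : Fin n → ℕ) → foldr _ _+_ 0 (tabulate f) ≡ ∑[ x ∈ ⊤ ] f x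
foldr-+-tabulate {zero}  f = refl
foldr-+-tabulate {suc n} f = cong (f zero +_) (foldr-+-tabulate (f ∘ suc))

foldr-⊔-tabulate : ∀ (f : Fin n → ℕ) x → f x ≤ foldr _ _⊔_ 0 (tabulate f)
foldr-⊔-tabulate f zero    = m≤m⊔n (f zero) _
foldr-⊔-tabulate f (suc x) = ≤-trans (foldr-⊔-tabulate (f ∘ suc) x) (m≤n⊔m (f zero) _)

module _ (D : Digraph n) where

  ∈N⁻⇔ : ∀ {x y} → y ∈ N⁻ D x ⇔ Arc D y x
  ∈N⁻⇔ {x} {y} = mk⇔
    (λ y∈N⁻x → lookup⇒[]= x (D y) (Equivalence.to T-≡ (Equivalence.to (∈-tabulate in-arc) y∈N⁻x)))
    (λ y→x → Equivalence.from (∈-tabulate in-arc) (Equivalence.from T-≡ ([]=⇒lookup y→x)))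
    where in-arc = λ y → lookup (D y) x

  d⁺≤Δ⁺ : ∀ u → d⁺ D u ≤ Δ⁺ D
  d⁺≤Δ⁺ = foldr-⊔-tabulate (d⁺ D)

  deficit : Fin n → ℕ
  deficit u = Δ⁺ D ∸ d⁺ D u

  d⁺+deficit≡Δ⁺ : ∀ u → d⁺ D u + deficit u ≡ Δ⁺ D
  d⁺+deficit≡Δ⁺ u = m+[n∸m]≡n (d⁺≤Δ⁺ u)

  FFree⇒∑d⁺≤n : FFree D → ∀ w → ∑[ y ∈ N⁺ D w ] d⁺ D y ≤ n
  FFree⇒∑d⁺≤n ffree w = sumOver-disjoint-≤ (N⁺ D w) (N⁺ D)
    (λ y∈ y′∈ z∈ z∈′ → ffree w _ _ _ y∈ z∈ y′∈ z∈′)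

  arcs+deficits≤ : FFree D → ∀ w →
                   arcs D + ∑[ y ∈ ∁ (N⁺ D w) ] deficit y ≤ n + ∣ ∁ (N⁺ D w) ∣ * Δ⁺ D
  arcs+deficits≤ ffree w = begin
    arcs D + ∑[ y ∈ ∁ N ] deficit y
      ≡⟨ cong (_+ ∑[ y ∈ ∁ N ] deficit y) (trans (foldr-+-tabulate (d⁺ D)) (sumOver-⊤ N (d⁺ D))) ⟩
    ∑[ y ∈ N ] d⁺ D y + ∑[ y ∈ ∁ N ] d⁺ D y + ∑[ y ∈ ∁ N ] deficit y
      ≡⟨ +-assoc (∑[ y ∈ N ] d⁺ D y) _ _ ⟩
    ∑[ y ∈ N ] d⁺ D y + (∑[ y ∈ ∁ N ] d⁺ D y + ∑[ y ∈ ∁ N ] deficit y)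
      ≡⟨ cong (∑[ y ∈ N ] d⁺ D y +_) outside-sum ⟩
    ∑[ y ∈ N ] d⁺ D y + ∣ ∁ N ∣ * Δ⁺ D
      ≤⟨ +-monoˡ-≤ _ (FFree⇒∑d⁺≤n ffree w) ⟩
    n + ∣ ∁ N ∣ * Δ⁺ D ∎
    where
    open ≤-Reasoning
    N = N⁺ D w
    outside-sum : ∑[ y ∈ ∁ N ] d⁺ D y + ∑[ y ∈ ∁ N ] deficit y ≡ ∣ ∁ N ∣ * Δ⁺ D
    outside-sum = begin-equality
      ∑[ y ∈ ∁ N ] d⁺ D y + ∑[ y ∈ ∁ N ] deficit y  ≡⟨ sumOver-+ (∁ N) (d⁺ D) deficit ⟨
      ∑[ y ∈ ∁ N ] (d⁺ D y + deficit y)            ≡⟨ sumOver-cong (∁ N) (λ {y} _ → d⁺+deficit≡Δ⁺ y) ⟩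
      ∑[ y ∈ ∁ N ] Δ⁺ D                            ≡⟨ sumOver-const (∁ N) (Δ⁺ D) ⟩
      ∣ ∁ N ∣ * Δ⁺ D ∎

FFree-criterion : ∀ (D : Digraph n) (L : Fin n → Set) →
                  (∀ {a b w} → L a → L b → Arc D a w → Arc D b w → a ≡ b) →
                  (∀ u → (∀ {a} → Arc D u a → L a) ⊎ (∀ {a b} → Arc D u a → Arc D u b → a ≡ b)) →
                  FFree D
FFree-criterion D L disjoint-from-L narrow u a b w u→a a→w u→b b→w with narrow u
... | inj₁ into-L  = disjoint-from-L (into-L u→a) (into-L u→b) a→w b→w
... | inj₂ at-most-one = at-most-one u→a u→b

-- F-free because the vertices below 2 + c, the only targets of vertices with several
-- out-neighbours, have pairwise disjoint out-neighbourhoods.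
module Construction (c a : ℕ) (c≤a : c ≤ a) where

  data Edge : ℕ → ℕ → Set where
    from-high : ∀ {i j} → 2 + c ≤ i → j < 2 + c → Edge i j
    from-0    : ∀ {j} → 1 ≤ j → j < 2 + c → Edge 0 j
    from-1    : Edge 1 0
    matching  : ∀ {k} → k < c → Edge (2 + k) (2 + c + k)

  high-target : ∀ {i j} → 2 + c ≤ i → Edge i j → j < 2 + c
  high-target _                (from-high _ j<2+c) = j<2+c
  high-target (s≤s ())        from-1
  high-target (s≤s (s≤s c≤k)) (matching k<c)      = ⊥-elim (<⇒≱ k<c c≤k)

  Edge? : ∀ i j → Dec (Edge i j)
  Edge? i j with 2 + c ≤? i
  ... | yes high = map′ (from-high high) (high-target high) (j <? 2 + c)
  Edge? zero j | no _ =
    map′ (λ (1≤j , j<2+c) → from-0 1≤j j<2+c) (λ { (from-0 1≤j j<2+c) → 1≤j , j<2+c })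
         (1 ≤? j ×-dec j <? 2 + c)
  Edge? (suc zero) j | no _ =
    map′ (λ { refl → from-1 }) (λ { from-1 → refl ; (from-high (s≤s ()) _) }) (j ≟ℕ 0)
  Edge? (suc (suc k)) j | no low =
    map′ (λ { refl → matching (s≤s⁻¹ (s≤s⁻¹ (≰⇒> low))) })
         (λ { (matching _) → refl ; (from-high high _) → ⊥-elim (low high) })
         (j ≟ℕ 2 + c + k)

  N : ℕ
  N = 2 + c + a

  D₀ : Digraph N
  D₀ u = tabulate (λ w → ⌊ Edge? (toℕ u) (toℕ w) ⌋)

  edge : ∀ {u w} → Arc D₀ u w → Edge (toℕ u) (toℕ w)
  edge {u} {w} = toWitness ∘ Equivalence.to (∈-tabulate (λ w → ⌊ Edge? (toℕ u) (toℕ w) ⌋))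

  arc : ∀ {u w} → Edge (toℕ u) (toℕ w) → Arc D₀ u w
  arc {u} {w} = Equivalence.from (∈-tabulate (λ w → ⌊ Edge? (toℕ u) (toℕ w) ⌋)) ∘ fromWitness

  edge-irreflexive : ∀ {i j} → Edge i j → i ≢ j
  edge-irreflexive (from-high high j<2+c) i≡j  = <⇒≱ j<2+c (subst (2 + c ≤_) i≡j high)
  edge-irreflexive (from-0 () _)          refl
  edge-irreflexive from-1                 ()
  edge-irreflexive (matching k<c)         eq   = <⇒≢ (<-≤-trans k<c (m≤m+n _ _)) (cong (_∸ 2) eq)

  low-sources-disjoint : ∀ {i i′ j j′} → Edge i j → Edge i′ j′ → j ≡ j′ → i < 2 + c → i′ < 2 + c → i ≡ i′
  low-sources-disjoint (from-high high _) _ _ i<2+c _ = ⊥-elim (<⇒≱ i<2+c high)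
  low-sources-disjoint _ (from-high high _) _ _ i′<2+c = ⊥-elim (<⇒≱ i′<2+c high)
  low-sources-disjoint (from-0 _ _)        (from-0 _ _)        _    _ _ = refl
  low-sources-disjoint (from-0 () _)       from-1              refl _ _
  low-sources-disjoint (from-0 _ j<2+c)    (matching _)        refl _ _ = ⊥-elim (<⇒≱ j<2+c (m≤m+n _ _))
  low-sources-disjoint from-1              (from-0 () _)       refl _ _
  low-sources-disjoint from-1              from-1              _    _ _ = refl
  low-sources-disjoint (matching _)        (from-0 _ j′<2+c)   refl _ _ = ⊥-elim (<⇒≱ j′<2+c (m≤m+n _ _))
  low-sources-disjoint (matching _)        (matching _)        eq   _ _ =
    cong (2 +_) (+-cancelˡ-≡ (2 + c) _ _ eq)

  targets-low-or-unique : ∀ i → (∀ {j} → Edge i j → j < 2 + c) ⊎ (∀ {j j′} → Edge i j → Edge i j′ → j ≡ j′)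
  targets-low-or-unique i with 2 + c ≤? i
  ... | yes high = inj₁ (high-target high)
  targets-low-or-unique zero          | no _ = inj₁ λ { (from-0 _ j<2+c) → j<2+c }
  targets-low-or-unique (suc zero)    | no _ = inj₁ λ { from-1 → s≤s z≤n ; (from-high (s≤s ()) _) }
  targets-low-or-unique (suc (suc k)) | no low = inj₂ λ
    { (matching _) (matching _) → refl
    ; (from-high high _) _ → ⊥-elim (low high)
    ; _ (from-high high _) → ⊥-elim (low high) }

  loopless : Loopless D₀
  loopless u u→u = edge-irreflexive (edge u→u) refl

  ffree : FFree D₀
  ffree = FFree-criterion D₀ (λ w → toℕ w < 2 + c)
    (λ a<2+c b<2+c a→w b→w → toℕ-injective (low-sources-disjoint (edge a→w) (edge b→w) refl a<2+c b<2+c))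
    (λ u → ⊎-map (λ low u→a → low (edge u→a))
                 (λ unique u→a u→b → toℕ-injective (unique (edge u→a) (edge u→b)))
                 (targets-low-or-unique (toℕ u)))

  Low : Subset N
  Low = tabulate (λ w → toℕ w <ᵇ 2 + c)

  ∈Low⇔ : ∀ {w} → w ∈ Low ⇔ toℕ w < 2 + c
  ∈Low⇔ = mk⇔ (<ᵇ⇒< _ _ ∘ Equivalence.to (∈-tabulate low)) (Equivalence.from (∈-tabulate low) ∘ <⇒<ᵇ)
    where low = λ (w : Fin N) → toℕ w <ᵇ 2 + c

  ∣Low∣ : ∣ Low ∣ ≡ 2 + c
  ∣Low∣ = trans (∣tabulate-<ᵇ∣ N (2 + c)) (m≤n⇒m⊓n≡m (m≤m+n (2 + c) a))

  ∣∁Low∣ : ∣ ∁ Low ∣ ≡ a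
  ∣∁Low∣ = trans (∣∁p∣≡n∸∣p∣ Low) (trans (cong (N ∸_) ∣Low∣) (m+n∸m≡n (2 + c) a))

  high-degree : ∀ {u} → u ∈ ∁ Low → 2 + c ≤ d⁺ D₀ u
  high-degree {u} u∉Low = subst (_≤ d⁺ D₀ u) ∣Low∣ (p⊆q⇒∣p∣≤∣q∣ Low⊆out)
    where
    Low⊆out : Low ⊆ N⁺ D₀ u
    Low⊆out w∈Low = arc (from-high (≮⇒≥ (x∈∁p⇒x∉p u∉Low ∘ Equivalence.from ∈Low⇔))
                                   (Equivalence.to ∈Low⇔ w∈Low))

  0∈Low : zero ∈ Low
  0∈Low = Equivalence.from ∈Low⇔ (s≤s z≤n)

  ∣Low-0∣ : ∣ Low - zero ∣ ≡ 1 + c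
  ∣Low-0∣ = cong pred (trans (sym (x∈p⇒∣p∣≡1+∣p-x∣ 0∈Low)) ∣Low∣)

  degree-0 : 1 + c ≤ d⁺ D₀ zero
  degree-0 = subst (_≤ d⁺ D₀ zero) ∣Low-0∣ (p⊆q⇒∣p∣≤∣q∣ Low-0⊆out)
    where
    Low-0⊆out : Low - zero ⊆ N⁺ D₀ zero
    Low-0⊆out {zero}  w∈ = contradiction refl (x∈p-y⇒x≢y {p = Low} w∈)
    Low-0⊆out {suc w} w∈ = arc (from-0 (s≤s z≤n) (Equivalence.to ∈Low⇔ (p─q⊆p Low ⁅ zero ⁆ w∈)))

  low-edge : ∀ {i} → i < 2 + c → ∃ λ j → j < N × Edge i j
  low-edge {zero}        _               = 1 , s≤s (s≤s z≤n) , from-0 (s≤s z≤n) (s≤s (s≤s z≤n))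
  low-edge {suc zero}    _               = 0 , s≤s z≤n , from-1
  low-edge {suc (suc k)} (s≤s (s≤s k<c)) = 2 + c + k , +-monoʳ-< (2 + c) (<-≤-trans k<c c≤a) , matching k<c

  low-degree : ∀ {u} → u ∈ Low → 1 ≤ d⁺ D₀ u
  low-degree {u} u∈Low with low-edge (Equivalence.to ∈Low⇔ u∈Low)
  ... | j , j<N , u→j = x∈p⇒0<∣p∣ (arc {u} {fromℕ< j<N} (subst (Edge (toℕ u)) (sym (toℕ-fromℕ< j<N)) u→j))

  arcs-D₀ : suc c * suc a + suc (c + a) ≤ arcs D₀
  arcs-D₀ = begin
    suc c * suc a + suc (c + a)
      ≡⟨ regroup c a ⟩
    (1 + c) + (1 + c) * 1 + a * (2 + c)
      ≤⟨ +-mono-≤ (+-mono-≤ degree-0 low-part) high-part ⟩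
    d⁺ D₀ zero + ∑[ u ∈ Low - zero ] d⁺ D₀ u + ∑[ u ∈ ∁ Low ] d⁺ D₀ u
      ≡⟨ cong (_+ ∑[ u ∈ ∁ Low ] d⁺ D₀ u) (sumOver-remove (d⁺ D₀) 0∈Low) ⟨
    ∑[ u ∈ Low ] d⁺ D₀ u + ∑[ u ∈ ∁ Low ] d⁺ D₀ u
      ≡⟨ trans (foldr-+-tabulate (d⁺ D₀)) (sumOver-⊤ Low (d⁺ D₀)) ⟨
    arcs D₀ ∎
    where
    open ≤-Reasoning
    regroup : ∀ c a → suc c * suc a + suc (c + a) ≡ (1 + c) + (1 + c) * 1 + a * (2 + c)
    regroup = solve-∀
    low-part : (1 + c) * 1 ≤ ∑[ u ∈ Low - zero ] d⁺ D₀ u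
    low-part = ≤-trans (≤-reflexive (cong (_* 1) (sym ∣Low-0∣)))
                       (∣p∣*k≤sumOver (Low - zero) 1 (low-degree ∘ p─q⊆p Low ⁅ zero ⁆))
    high-part : a * (2 + c) ≤ ∑[ u ∈ ∁ Low ] d⁺ D₀ u
    high-part = ≤-trans (≤-reflexive (cong (_* (2 + c)) (sym ∣∁Low∣)))
                        (∣p∣*k≤sumOver (∁ Low) (2 + c) high-degree)

InEX⇒construction≤arcs : ∀ {D : Digraph n} → InEX n D →
                         ∀ {c a} → c ≤ a → 2 + c + a ≡ n → suc c * suc a + suc (c + a) ≤ arcs D
InEX⇒construction≤arcs (_ , _ , maximal) {c} {a} c≤a refl = ≤-trans arcs-D₀ (maximal D₀ loopless ffree)
  where open Construction c a c≤a

ex-lower-bound : ∀ {D : Digraph n} → InEX n D →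
                 ∀ c a → 2 + c + a ≡ n → suc c * suc a + suc (c + a) ≤ arcs D
ex-lower-bound {D = D} ex c a 2+c+a≡n with ≤-total c a
... | inj₁ c≤a = InEX⇒construction≤arcs ex c≤a 2+c+a≡n
... | inj₂ a≤c = subst (_≤ arcs D) (swap c a)
                       (InEX⇒construction≤arcs ex a≤c (trans (cong (2 +_) (+-comm a c)) 2+c+a≡n))
  where
  swap : ∀ c a → suc a * suc c + suc (a + c) ≡ suc c * suc a + suc (c + a)
  swap = solve-∀

-- X, σ and x + Δ stand for the number of arcs, the slack and n; the pairs (c , a) fed to
-- the lower bound are (x − 1 , Δ − 1), (Δ , Δ) and (Δ + 1 + k , Δ).
module _ {x Δ X σ : ℕ} (X+σ≡ : X + σ ≡ x + Δ + x * Δ)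
         (lower : ∀ c a → 2 + c + a ≡ x + Δ → suc c * suc a + suc (c + a) ≤ X) where

  private
    lower+σ : ∀ c a → 2 + c + a ≡ x + Δ → suc c * suc a + suc (c + a) + σ ≤ x + Δ + x * Δ
    lower+σ c a eq = ≤-trans (+-monoˡ-≤ σ (lower c a eq)) (≤-reflexive X+σ≡)

  unbalanced-impossible : 3 + Δ ≤ x → ⊥
  unbalanced-impossible 3+Δ≤x with m≤n⇒∃[o]m+o≡n 3+Δ≤x
  ... | k , refl = 1+n≰n (begin
    suc R                                                       ≤⟨ s≤s (m≤n+m R k) ⟩
    suc (k + R)                                                 ≡⟨ excess Δ k ⟨
    suc c * suc Δ + suc (c + Δ)                                 ≤⟨ m≤m+n _ σ ⟩
    suc c * suc Δ + suc (c + Δ) + σ                             ≤⟨ lower+σ c Δ refl ⟩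
    R                                                           ∎)
    where
    open ≤-Reasoning
    c = 1 + Δ + k
    R = 3 + Δ + k + Δ + (3 + Δ + k) * Δ
    excess : ∀ Δ k → suc (1 + Δ + k) * suc Δ + suc (1 + Δ + k + Δ)
                     ≡ suc (k + (3 + Δ + k + Δ + (3 + Δ + k) * Δ))
    excess = solve-∀

  balanced-slack : x ≡ 2 + Δ → σ ≡ 0
  balanced-slack refl = n≤0⇒n≡0 (+-cancelˡ-≤ V σ 0 (≤-trans (lower+σ Δ Δ refl) (≤-reflexive (exact Δ))))
    where
    V = suc Δ * suc Δ + suc (Δ + Δ)
    exact : ∀ Δ → 2 + Δ + Δ + (2 + Δ) * Δ ≡ suc Δ * suc Δ + suc (Δ + Δ) + 0
    exact = solve-∀

  near-balanced-slack : 1 ≤ x → 1 ≤ Δ → σ ≤ 1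
  near-balanced-slack (s≤s {n = c} z≤n) (s≤s {n = a} z≤n) =
    +-cancelˡ-≤ V σ 1 (≤-trans (lower+σ c a (cong suc (sym (+-suc c a)))) (≤-reflexive (exact c a)))
    where
    V = suc c * suc a + suc (c + a)
    exact : ∀ c a → suc c + suc a + suc c * suc a ≡ suc c * suc a + suc (c + a) + 1
    exact = solve-∀

  slack-bounds : 8 ≤ x + Δ → 1 ≤ x → σ ≤ 1 × 2 + σ < Δ × x + Δ + σ + σ < Δ + Δ + Δ
  slack-bounds 8≤x+Δ 1≤x with <-cmp x (2 + Δ)
  ... | tri> _ _ 2+Δ<x = ⊥-elim (unbalanced-impossible 2+Δ<x)
  ... | tri≈ _ refl _ rewrite balanced-slack refl = z≤n , 3≤Δ , (begin-strict
    2 + Δ + Δ + 0 + 0  ≡⟨ solve-∀′ Δ ⟩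
    Δ + Δ + 2          <⟨ +-monoʳ-< (Δ + Δ) 3≤Δ ⟩
    Δ + Δ + Δ          ∎)
    where
    open ≤-Reasoning
    3≤Δ : 3 ≤ Δ
    3≤Δ = ≰⇒> λ Δ≤2 → <⇒≱ 8≤x+Δ (+-mono-≤ (+-monoʳ-≤ 2 Δ≤2) (≤-trans Δ≤2 (n≤1+n 2)))
    solve-∀′ : ∀ Δ → 2 + Δ + Δ + 0 + 0 ≡ Δ + Δ + 2
    solve-∀′ = solve-∀
  ... | tri< x<2+Δ _ _ = σ≤1 , ≤-trans (s≤s (s≤s (s≤s σ≤1))) 4≤Δ , (begin-strict
    x + Δ + σ + σ      ≤⟨ +-mono-≤ (+-mono-≤ (+-monoˡ-≤ Δ (s≤s⁻¹ x<2+Δ)) σ≤1) σ≤1 ⟩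
    1 + Δ + Δ + 1 + 1  ≡⟨ solve-∀′ Δ ⟩
    Δ + Δ + 3          <⟨ +-monoʳ-< (Δ + Δ) 4≤Δ ⟩
    Δ + Δ + Δ          ∎)
    where
    open ≤-Reasoning
    4≤Δ : 4 ≤ Δ
    4≤Δ = ≰⇒> λ Δ≤3 → <⇒≱ 8≤x+Δ (+-mono-≤ (≤-trans (s≤s⁻¹ x<2+Δ) (s≤s Δ≤3)) Δ≤3)
    σ≤1 : σ ≤ 1
    σ≤1 = near-balanced-slack 1≤x (≤-trans (s≤s z≤n) 4≤Δ)
    solve-∀′ : ∀ Δ → 1 + Δ + Δ + 1 + 1 ≡ Δ + Δ + 3
    solve-∀′ = solve-∀

module Extremal {n : ℕ} (D : Digraph n) (8≤n : 8 ≤ n) (ex : InEX n D)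
                (v : Fin n) (v-full : d⁺ D v ≡ Δ⁺ D) where

  loopless : Loopless D
  loopless = proj₁ ex

  ffree : FFree D
  ffree = proj₁ (proj₂ ex)

  Δ : ℕ
  Δ = Δ⁺ D

  V₁ : Subset n
  V₁ = N⁺ D v

  V₂ : Subset n
  V₂ = ∁ V₁

  missedDeficit : Fin n → ℕ
  missedDeficit w = ∑[ y ∈ ∁ (N⁺ D w) ] deficit D y

  ∣V₂∣+Δ≡n : ∣ V₂ ∣ + Δ ≡ n
  ∣V₂∣+Δ≡n = trans (cong₂ _+_ (∣∁p∣≡n∸∣p∣ V₁) (sym v-full)) (m∸n+n≡m (∣p∣≤n V₁))

  ∣∁N⁺∣≡∣V₂∣ : ∀ {w} → d⁺ D w ≡ Δ → ∣ ∁ (N⁺ D w) ∣ ≡ ∣ V₂ ∣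
  ∣∁N⁺∣≡∣V₂∣ {w} w-full = begin
    ∣ ∁ (N⁺ D w) ∣   ≡⟨ ∣∁p∣≡n∸∣p∣ (N⁺ D w) ⟩
    n ∸ d⁺ D w       ≡⟨ cong (n ∸_) (trans w-full (sym v-full)) ⟩
    n ∸ ∣ V₁ ∣       ≡⟨ ∣∁p∣≡n∸∣p∣ V₁ ⟨
    ∣ V₂ ∣           ∎
    where open ≡-Reasoning

  arcs+missedDeficit≤ : ∀ {w} → d⁺ D w ≡ Δ → arcs D + missedDeficit w ≤ n + ∣ V₂ ∣ * Δ
  arcs+missedDeficit≤ {w} w-full =
    subst (λ k → arcs D + missedDeficit w ≤ n + k * Δ) (∣∁N⁺∣≡∣V₂∣ w-full) (arcs+deficits≤ D ffree w)

  slack : ℕ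
  slack = n + ∣ V₂ ∣ * Δ ∸ arcs D

  missedDeficit≤slack : ∀ {w} → d⁺ D w ≡ Δ → missedDeficit w ≤ slack
  missedDeficit≤slack {w} w-full =
    m+n≤o⇒m≤o∸n _ (subst (_≤ n + ∣ V₂ ∣ * Δ) (+-comm (arcs D) _) (arcs+missedDeficit≤ w-full))

  private
    bounds : slack ≤ 1 × 2 + slack < Δ × ∣ V₂ ∣ + Δ + slack + slack < Δ + Δ + Δ
    bounds = slack-bounds {X = arcs D} X+σ≡ lower (subst (8 ≤_) (sym ∣V₂∣+Δ≡n) 8≤n) 0<∣V₂∣
      where
      X+σ≡ : arcs D + slack ≡ ∣ V₂ ∣ + Δ + ∣ V₂ ∣ * Δ
      X+σ≡ = trans (m+[n∸m]≡n (m+n≤o⇒m≤o (arcs D) (arcs+missedDeficit≤ v-full)))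
                   (cong (_+ ∣ V₂ ∣ * Δ) (sym ∣V₂∣+Δ≡n))
      lower : ∀ c a → 2 + c + a ≡ ∣ V₂ ∣ + Δ → suc c * suc a + suc (c + a) ≤ arcs D
      lower c a eq = ex-lower-bound ex c a (trans eq ∣V₂∣+Δ≡n)
      0<∣V₂∣ : 0 < ∣ V₂ ∣
      0<∣V₂∣ = x∈p⇒0<∣p∣ (x∉p⇒x∈∁p (loopless v))

  slack≤1 : slack ≤ 1
  slack≤1 = proj₁ bounds

  2+slack<Δ : 2 + slack < Δ
  2+slack<Δ = proj₁ (proj₂ bounds)

  n+2slack<3Δ : n + slack + slack < Δ + Δ + Δ
  n+2slack<3Δ = subst (λ k → k + slack + slack < Δ + Δ + Δ) ∣V₂∣+Δ≡n (proj₂ (proj₂ bounds))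

  deficit≡0⇒full : ∀ {y} → deficit D y ≡ 0 → d⁺ D y ≡ Δ
  deficit≡0⇒full {y} eq = trans (sym (+-identityʳ _)) (trans (cong (d⁺ D y +_) (sym eq)) (d⁺+deficit≡Δ⁺ D y))

  ¬full⇒0<deficit : ∀ {y} → d⁺ D y ≢ Δ → 0 < deficit D y
  ¬full⇒0<deficit ¬full = n≢0⇒n>0 (¬full ∘ deficit≡0⇒full)

  missed-deficit≤slack : ∀ {w y} → d⁺ D w ≡ Δ → y ∉ N⁺ D w → deficit D y ≤ slack
  missed-deficit≤slack w-full y∉ = ≤-trans (sumOver-≥₁ (deficit D) (x∉p⇒x∈∁p y∉)) (missedDeficit≤slack w-full)

  missed-deficits≤slack : ∀ {w y y′} → d⁺ D w ≡ Δ → y ∉ N⁺ D w → y′ ∉ N⁺ D w → y ≢ y′ →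
                          deficit D y + deficit D y′ ≤ slack
  missed-deficits≤slack w-full y∉ y′∉ y≢y′ =
    ≤-trans (sumOver-≥₂ (deficit D) (x∉p⇒x∈∁p y∉) (x∉p⇒x∈∁p y′∉) y≢y′) (missedDeficit≤slack w-full)

  at-most-one-deficient-missed : ∀ {w y y′} → d⁺ D w ≡ Δ → y ∉ N⁺ D w → y′ ∉ N⁺ D w → y ≢ y′ →
                                 d⁺ D y ≢ Δ → d⁺ D y′ ≡ Δ
  at-most-one-deficient-missed w-full y∉ y′∉ y≢y′ ¬full = deficit≡0⇒full (n≤0⇒n≡0 (+-cancelˡ-≤ 1 _ 0 (begin
    1 + deficit D _                ≤⟨ +-monoˡ-≤ _ (¬full⇒0<deficit ¬full) ⟩
    deficit D _ + deficit D _      ≤⟨ missed-deficits≤slack w-full y∉ y′∉ y≢y′ ⟩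
    slack                          ≤⟨ slack≤1 ⟩
    1                              ≡⟨ +-identityʳ 1 ⟨
    1 + 0                          ∎)))
    where open ≤-Reasoning

  slack+slack<deficits : ∀ {u y₁ y₂ y₃} → y₁ ∈ N⁺ D u → y₂ ∈ N⁺ D u → y₃ ∈ N⁺ D u →
                         y₁ ≢ y₂ → y₁ ≢ y₃ → y₂ ≢ y₃ →
                         slack + slack < deficit D y₁ + deficit D y₂ + deficit D y₃
  slack+slack<deficits {u} {y₁} {y₂} {y₃} y₁∈ y₂∈ y₃∈ y₁≢y₂ y₁≢y₃ y₂≢y₃ = +-cancelˡ-< n _ _ (begin-strict
    n + (slack + slack)          ≡⟨ +-assoc n slack slack ⟨
    n + slack + slack            <⟨ n+2slack<3Δ ⟩
    Δ + Δ + Δ                    ≡⟨ cong₂ _+_ (cong₂ _+_ (full y₁) (full y₂)) (full y₃) ⟨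
    (d y₁ + e y₁) + (d y₂ + e y₂) + (d y₃ + e y₃) ≡⟨ regroup (d y₁) (d y₂) (d y₃) (e y₁) (e y₂) (e y₃) ⟩
    (d y₁ + d y₂ + d y₃) + (e y₁ + e y₂ + e y₃)
      ≤⟨ +-monoˡ-≤ _ (≤-trans (sumOver-≥₃ d y₁∈ y₂∈ y₃∈ y₁≢y₂ y₁≢y₃ y₂≢y₃) (FFree⇒∑d⁺≤n D ffree u)) ⟩
    n + (e y₁ + e y₂ + e y₃)     ∎)
    where
    open ≤-Reasoning
    d = d⁺ D
    e = deficit D
    full = d⁺+deficit≡Δ⁺ D
    regroup : ∀ a b c a′ b′ c′ → (a + a′) + (b + b′) + (c + c′) ≡ (a + b + c) + (a′ + b′ + c′)
    regroup = solve-∀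

  ∣N⁺∩V₂∣≤2 : ∀ u → ∣ N⁺ D u ∩ V₂ ∣ ≤ 2
  ∣N⁺∩V₂∣≤2 u with ∣ N⁺ D u ∩ V₂ ∣ ≤? 2
  ... | yes ≤2 = ≤2
  ... | no  ≰2 with y₁ , y₂ , y₃ , (y₁∈ , y₂∈ , y₃∈) , (y₁≢y₂ , y₁≢y₃ , y₂≢y₃) ← ∃-distinct-triple (≰⇒> ≰2)
    = ⊥-elim (<⇒≱ (slack+slack<deficits (out y₁∈) (out y₂∈) (out y₃∈) y₁≢y₂ y₁≢y₃ y₂≢y₃) (begin
        deficit D y₁ + deficit D y₂ + deficit D y₃
          ≤⟨ sumOver-≥₃ (deficit D) (missed y₁∈) (missed y₂∈) (missed y₃∈) y₁≢y₂ y₁≢y₃ y₂≢y₃ ⟩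
        missedDeficit v ≤⟨ missedDeficit≤slack v-full ⟩
        slack            ≤⟨ m≤m+n slack slack ⟩
        slack + slack    ∎))
    where
    open ≤-Reasoning
    out : ∀ {y} → y ∈ N⁺ D u ∩ V₂ → y ∈ N⁺ D u
    out = proj₁ ∘ x∈p∩q⁻ _ _
    missed : ∀ {y} → y ∈ N⁺ D u ∩ V₂ → y ∈ V₂
    missed = proj₂ ∘ x∈p∩q⁻ _ _

  full⇒meets-V₁ : ∀ {u} → d⁺ D u ≡ Δ → Nonempty (N⁺ D u ∩ V₁)
  full⇒meets-V₁ {u} u-full = ∣p∣>0⇒nonempty (+-cancelʳ-< 2 0 _ (begin-strict
    0 + 2                              <⟨ m+n≤o⇒m≤o 3 2+slack<Δ ⟩
    Δ                                  ≡⟨ trans (sym u-full) (∣p∣≡∣p∩q∣+∣p∩∁q∣ (N⁺ D u) V₁) ⟩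
    ∣ N⁺ D u ∩ V₁ ∣ + ∣ N⁺ D u ∩ V₂ ∣  ≤⟨ +-monoʳ-≤ _ (∣N⁺∩V₂∣≤2 u) ⟩
    ∣ N⁺ D u ∩ V₁ ∣ + 2                ∎))
    where open ≤-Reasoning

  V₁-neighbours-shared : ∀ {u b₁ b₂ z w} → b₁ ∈ N⁺ D u → b₁ ∉ V₁ → b₂ ∈ N⁺ D u → b₂ ∉ V₁ → b₁ ≢ b₂ →
                         z ∈ N⁺ D u → z ∈ V₁ → d⁺ D w ≡ Δ → z ∈ N⁺ D w
  V₁-neighbours-shared {b₁ = b₁} {b₂} {z} {w} b₁∈ b₁∉ b₂∈ b₂∉ b₁≢b₂ z∈ z∈V₁ w-full with z ∈? N⁺ D w
  ... | yes z∈N⁺w = z∈N⁺w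
  ... | no  z∉N⁺w = ⊥-elim (<⇒≱ (slack+slack<deficits z∈ b₁∈ b₂∈ (z≢ b₁∉) (z≢ b₂∉) b₁≢b₂) (begin
    deficit D z + deficit D b₁ + deficit D b₂    ≡⟨ +-assoc (deficit D z) _ _ ⟩
    deficit D z + (deficit D b₁ + deficit D b₂)  ≤⟨ +-mono-≤ (missed-deficit≤slack w-full z∉N⁺w)
                                                             (missed-deficits≤slack v-full b₁∉ b₂∉ b₁≢b₂) ⟩
    slack + slack                                ∎))
    where
    open ≤-Reasoning
    z≢ : ∀ {b} → b ∉ V₁ → z ≢ b
    z≢ b∉V₁ refl = b∉V₁ z∈V₁

  UniqueInNeighbourInV₁ : Set
  UniqueInNeighbourInV₁ = ∀ y → y ∈ V₁ → ∣ N⁻ D y ∩ V₁ ∣ ≡ 1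

  module TwoOutside (unique-in : UniqueInNeighbourInV₁) {u} (u-full : d⁺ D u ≡ Δ)
                    {b₁ b₂} (b₁∈ : b₁ ∈ N⁺ D u) (b₁∉ : b₁ ∉ V₁) (b₂∈ : b₂ ∈ N⁺ D u) (b₂∉ : b₂ ∉ V₁)
                    (b₁≢b₂ : b₁ ≢ b₂) where

    shared : ∀ {z w} → z ∈ N⁺ D u → z ∈ V₁ → d⁺ D w ≡ Δ → z ∈ N⁺ D w
    shared = V₁-neighbours-shared b₁∈ b₁∉ b₂∈ b₂∉ b₁≢b₂

    hub : Fin n
    hub = proj₁ (full⇒meets-V₁ u-full)

    hub∈ : hub ∈ N⁺ D u × hub ∈ V₁
    hub∈ = x∈p∩q⁻ _ _ (proj₂ (full⇒meets-V₁ u-full))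

    →hub : ∀ {w} → d⁺ D w ≡ Δ → Arc D w hub
    →hub = shared (proj₁ hub∈) (proj₂ hub∈)

    full-neighbours-equal : ∀ {m z z′} → z ∈ N⁺ D m → z′ ∈ N⁺ D m → d⁺ D z ≡ Δ → d⁺ D z′ ≡ Δ → z ≡ z′
    full-neighbours-equal z∈ z′∈ z-full z′-full = ffree _ _ _ hub z∈ (→hub z-full) z′∈ (→hub z′-full)

    1<∣V₁∖N⁺u∣ : 1 < ∣ V₁ ∩ ∁ (N⁺ D u) ∣
    1<∣V₁∖N⁺u∣ = subst (1 <_) (∣p∩∁q∣≡∣q∩∁p∣ (N⁺ D u) V₁ (trans u-full (sym v-full)))
                         (x≢y⇒2≤∣p∣ (x∈p∩q⁺ (b₁∈ , x∉p⇒x∈∁p b₁∉)) (x∈p∩q⁺ (b₂∈ , x∉p⇒x∈∁p b₂∉)) b₁≢b₂)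

    deficient-miss-impossible : ∀ {m m′} → m ∈ V₁ → m ∉ N⁺ D u → m′ ∈ V₁ → m′ ∉ N⁺ D u → m ≢ m′ →
                                d⁺ D m ≢ Δ → ⊥
    deficient-miss-impossible {m} {m′} m∈V₁ m∉ m′∈V₁ m′∉ m≢m′ m-deficient = <⇒≱ 2<d⁺m d⁺m≤2
      where
      m′-full : d⁺ D m′ ≡ Δ
      m′-full = at-most-one-deficient-missed u-full m∉ m′∉ m≢m′ m-deficient

      V₁-neighbour-missed : ∀ {z} → z ∈ N⁺ D m → z ∈ V₁ → z ∉ N⁺ D u
      V₁-neighbour-missed {z} m→z z∈V₁ u→z = m≢m′ (∣p∣≤1⇒≡ (≤-reflexive (unique-in z z∈V₁))
        (x∈p∩q⁺ (Equivalence.from (∈N⁻⇔ D) m→z , m∈V₁))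
        (x∈p∩q⁺ (Equivalence.from (∈N⁻⇔ D) (shared u→z z∈V₁ m′-full) , m′∈V₁)))

      classify : ∀ {z} → z ∈ N⁺ D m → d⁺ D z ≡ Δ ⊎ (z ∉ V₁ × d⁺ D z ≢ Δ)
      classify {z} m→z with d⁺ D z ≟ℕ Δ | z ∈? V₁
      ... | yes z-full | _      = inj₁ z-full
      ... | no  z-def  | no z∉  = inj₂ (z∉ , z-def)
      ... | no  z-def  | yes z∈ =
        ⊥-elim (z-def (at-most-one-deficient-missed u-full m∉ (V₁-neighbour-missed m→z z∈) m≢z m-deficient))
        where
        m≢z : m ≢ z
        m≢z refl = loopless m m→z

      deficient-outside-equal : ∀ {z z′} → z ∉ V₁ × d⁺ D z ≢ Δ → z′ ∉ V₁ × d⁺ D z′ ≢ Δ → z ≡ z′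
      deficient-outside-equal {z} {z′} (z∉ , z-def) (z′∉ , z′-def) with z ≟ z′
      ... | yes z≡z′ = z≡z′
      ... | no  z≢z′ = ⊥-elim (z′-def (at-most-one-deficient-missed v-full z∉ z′∉ z≢z′ z-def))

      d⁺m≤2 : d⁺ D m ≤ 2
      d⁺m≤2 = ∣p∣≤2 classify (λ z∈ z′∈ → full-neighbours-equal z∈ z′∈) (λ _ _ → deficient-outside-equal)

      2<d⁺m : 2 < d⁺ D m
      2<d⁺m = +-cancelʳ-< (deficit D m) 2 _ (begin-strict
        2 + deficit D m      ≤⟨ +-monoʳ-≤ 2 (missed-deficit≤slack u-full m∉) ⟩
        2 + slack            <⟨ 2+slack<Δ ⟩
        Δ                    ≡⟨ d⁺+deficit≡Δ⁺ D m ⟨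
        d⁺ D m + deficit D m ∎)
        where open ≤-Reasoning

    impossible : ⊥
    impossible with m₁ , m₂ , m₁∈ , m₂∈ , m₁≢m₂ ← ∃-distinct-pair 1<∣V₁∖N⁺u∣
                with m₁∈V₁ , m₁∉ ← x∈p∩q⁻ _ _ m₁∈ | m₂∈V₁ , m₂∉ ← x∈p∩q⁻ _ _ m₂∈
                with d⁺ D m₁ ≟ℕ Δ | d⁺ D m₂ ≟ℕ Δ
    ... | yes m₁-full | yes m₂-full = m₁≢m₂ (ffree v _ _ hub m₁∈V₁ (→hub m₁-full) m₂∈V₁ (→hub m₂-full))
    ... | no  m₁-def  | _           =
      deficient-miss-impossible m₁∈V₁ (x∈∁p⇒x∉p m₁∉) m₂∈V₁ (x∈∁p⇒x∉p m₂∉) m₁≢m₂ m₁-def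
    ... | yes _       | no m₂-def   =
      deficient-miss-impossible m₂∈V₁ (x∈∁p⇒x∉p m₂∉) m₁∈V₁ (x∈∁p⇒x∉p m₁∉) (m₁≢m₂ ∘ sym) m₂-def

  outside-neighbour-unique : UniqueInNeighbourInV₁ → ∀ {u} → d⁺ D u ≡ Δ →
                             ∀ {b₁ b₂} → b₁ ∈ N⁺ D u ∩ V₂ → b₂ ∈ N⁺ D u ∩ V₂ → b₁ ≡ b₂
  outside-neighbour-unique unique-in u-full {b₁} {b₂} b₁∈ b₂∈ with b₁ ≟ b₂
  ... | yes b₁≡b₂ = b₁≡b₂
  ... | no  b₁≢b₂ with b₁∈N⁺ , b₁∈V₂ ← x∈p∩q⁻ _ _ b₁∈ | b₂∈N⁺ , b₂∈V₂ ← x∈p∩q⁻ _ _ b₂∈ =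
    ⊥-elim (TwoOutside.impossible unique-in u-full b₁∈N⁺ (x∈∁p⇒x∉p b₁∈V₂) b₂∈N⁺ (x∈∁p⇒x∉p b₂∈V₂) b₁≢b₂)

  ∣N⁺∩V₂∣≤1 : UniqueInNeighbourInV₁ → ∀ {u} → d⁺ D u ≡ Δ → ∣ N⁺ D u ∩ V₂ ∣ ≤ 1
  ∣N⁺∩V₂∣≤1 unique-in u-full = ≡⇒∣p∣≤1 (outside-neighbour-unique unique-in u-full)

  Δ∸1≤∣N⁺∩V₁∣ : UniqueInNeighbourInV₁ → ∀ {u} → d⁺ D u ≡ Δ → Δ ∸ 1 ≤ ∣ N⁺ D u ∩ V₁ ∣
  Δ∸1≤∣N⁺∩V₁∣ unique-in {u} u-full = m≤n+o⇒m∸n≤o Δ 1 (begin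
    Δ                                  ≡⟨ trans (sym u-full) (∣p∣≡∣p∩q∣+∣p∩∁q∣ (N⁺ D u) V₁) ⟩
    ∣ N⁺ D u ∩ V₁ ∣ + ∣ N⁺ D u ∩ V₂ ∣  ≤⟨ +-monoʳ-≤ _ (∣N⁺∩V₂∣≤1 unique-in u-full) ⟩
    ∣ N⁺ D u ∩ V₁ ∣ + 1                ≡⟨ +-comm _ 1 ⟩
    1 + ∣ N⁺ D u ∩ V₁ ∣                ∎)
    where open ≤-Reasoning

  module OutsideArc {u₁ u₂} (u₂∉V₁ : u₂ ∉ V₁) (u₁→u₂ : Arc D u₁ u₂) where

    no-arc-between : ∀ a b → a ∈ N⁺ D u₁ ∩ V₁ → b ∈ N⁺ D u₂ ∩ V₁ → ¬ Arc D a b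
    no-arc-between a b a∈ b∈ a→b
      with a∈N⁺ , a∈V₁ ← x∈p∩q⁻ _ _ a∈
      with refl ← ffree u₁ a u₂ b a∈N⁺ a→b u₁→u₂ (proj₁ (x∈p∩q⁻ _ _ b∈)) = u₂∉V₁ a∈V₁

    module BothFull (unique-in : UniqueInNeighbourInV₁) (u₁-full : d⁺ D u₁ ≡ Δ) (u₂-full : d⁺ D u₂ ≡ Δ) where

      ∣N⁺u₁∩V₂∣≡1 : ∣ N⁺ D u₁ ∩ V₂ ∣ ≡ 1
      ∣N⁺u₁∩V₂∣≡1 = ≤-antisym (∣N⁺∩V₂∣≤1 unique-in u₁-full)
                              (x∈p⇒0<∣p∣ (x∈p∩q⁺ (u₁→u₂ , x∉p⇒x∈∁p u₂∉V₁)))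

      ∣N⁺u₁∩V₁∣≡Δ∸1 : ∣ N⁺ D u₁ ∩ V₁ ∣ ≡ Δ ∸ 1
      ∣N⁺u₁∩V₁∣≡Δ∸1 = begin
        ∣ N⁺ D u₁ ∩ V₁ ∣                          ≡⟨ m+n∸n≡m _ 1 ⟨
        ∣ N⁺ D u₁ ∩ V₁ ∣ + 1 ∸ 1                  ≡⟨ cong (λ k → ∣ N⁺ D u₁ ∩ V₁ ∣ + k ∸ 1) ∣N⁺u₁∩V₂∣≡1 ⟨
        ∣ N⁺ D u₁ ∩ V₁ ∣ + ∣ N⁺ D u₁ ∩ V₂ ∣ ∸ 1  ≡⟨ cong (_∸ 1) (∣p∣≡∣p∩q∣+∣p∩∁q∣ (N⁺ D u₁) V₁) ⟨
        d⁺ D u₁ ∸ 1                               ≡⟨ cong (_∸ 1) u₁-full ⟩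
        Δ ∸ 1                                     ∎
        where open ≡-Reasoning

      ∣V₁∖N⁺u₁∣≡1 : ∣ V₁ ∩ ∁ (N⁺ D u₁) ∣ ≡ 1
      ∣V₁∖N⁺u₁∣≡1 = trans (sym (∣p∩∁q∣≡∣q∩∁p∣ (N⁺ D u₁) V₁ (trans u₁-full (sym v-full)))) ∣N⁺u₁∩V₂∣≡1

      V₁∖N⁺u₁-nonempty : Nonempty (V₁ ∩ ∁ (N⁺ D u₁))
      V₁∖N⁺u₁-nonempty = ∣p∣>0⇒nonempty (≤-reflexive (sym ∣V₁∖N⁺u₁∣≡1))

      u₁′ : Fin n
      u₁′ = proj₁ V₁∖N⁺u₁-nonempty

      u₁′-missed : u₁′ ∈ V₁ × u₁′ ∉ N⁺ D u₁ × (∀ y → y ∈ V₁ → y ∉ N⁺ D u₁ → y ≡ u₁′)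
      u₁′-missed = u₁′∈V₁ , x∈∁p⇒x∉p u₁′∈∁N⁺ , λ y y∈V₁ y∉ →
        ∣p∣≤1⇒≡ (≤-reflexive ∣V₁∖N⁺u₁∣≡1) (x∈p∩q⁺ (y∈V₁ , x∉p⇒x∈∁p y∉)) u₁′∈
        where
        u₁′∈ = proj₂ V₁∖N⁺u₁-nonempty
        u₁′∈V₁ = proj₁ (x∈p∩q⁻ _ _ u₁′∈)
        u₁′∈∁N⁺ = proj₂ (x∈p∩q⁻ _ _ u₁′∈)

      u₁′→ : ∀ t → t ∈ N⁺ D u₂ ∩ V₁ → Arc D u₁′ t
      u₁′→ t t∈ with p , p∈ ← ∣p∣>0⇒nonempty {p = N⁻ D t ∩ V₁}
                                  (≤-reflexive (sym (unique-in t (proj₂ (x∈p∩q⁻ _ _ t∈)))))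
                with p∈N⁻ , p∈V₁ ← x∈p∩q⁻ _ _ p∈ =
        subst (λ q → Arc D q t) (proj₂ (proj₂ u₁′-missed) p p∈V₁ p∉N⁺u₁) p→t
        where
        p→t = Equivalence.to (∈N⁻⇔ D) p∈N⁻
        p∉N⁺u₁ : p ∉ N⁺ D u₁
        p∉N⁺u₁ p∈N⁺ = no-arc-between p t (x∈p∩q⁺ (p∈N⁺ , p∈V₁)) t∈ p→t

      N⁺u₂≢V₁ : N⁺ D u₂ ≢ V₁
      N⁺u₂≢V₁ eq = loopless u₁′ (u₁′→ u₁′ (x∈p∩q⁺ (subst (u₁′ ∈_) (sym eq) u₁′∈V₁ , u₁′∈V₁)))
        where u₁′∈V₁ = proj₁ u₁′-missed

      N⁺u₂∩V₁≡V₁-u₁′ : N⁺ D u₂ ∩ V₁ ≡ V₁ - u₁′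
      N⁺u₂∩V₁≡V₁-u₁′ = p⊆q∧∣q∣≤∣p∣⇒p≡q ⊆V₁-u₁′ (begin
        ∣ V₁ - u₁′ ∣         ≤⟨ ∸-monoˡ-≤ 1 (x∈p⇒∣p-x∣<∣p∣ (proj₁ u₁′-missed)) ⟩
        ∣ V₁ ∣ ∸ 1           ≡⟨ cong (_∸ 1) v-full ⟩
        Δ ∸ 1               ≤⟨ Δ∸1≤∣N⁺∩V₁∣ unique-in u₂-full ⟩
        ∣ N⁺ D u₂ ∩ V₁ ∣     ∎)
        where
        open ≤-Reasoning
        ⊆V₁-u₁′ : N⁺ D u₂ ∩ V₁ ⊆ V₁ - u₁′
        ⊆V₁-u₁′ {t} t∈ = x∈p∧x≢y⇒x∈p-y (proj₂ (x∈p∩q⁻ _ _ t∈)) λ { refl → loopless t (u₁′→ t t∈) }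

lemma6 : (n : ℕ) → 8 ≤ n → (D : Digraph n) → InEX n D →
         (v : Fin n) → d⁺ D v ≡ Δ⁺ D →
         (u₁ u₂ : Fin n) → u₁ ∈ ∁ (N⁺ D v) → u₂ ∈ ∁ (N⁺ D v) → Arc D u₁ u₂ →
         (∀ a b → a ∈ N⁺ D u₁ ∩ N⁺ D v → b ∈ N⁺ D u₂ ∩ N⁺ D v → ¬ Arc D a b)
         × ((∀ x → x ∈ N⁺ D v → ∣ N⁻ D x ∩ N⁺ D v ∣ ≡ 1) →
            d⁺ D u₁ ≡ Δ⁺ D → d⁺ D u₂ ≡ Δ⁺ D →
            ∣ N⁺ D u₁ ∩ N⁺ D v ∣ ≡ Δ⁺ D ∸ 1
            × Σ (Fin n) (λ u₁' →
                (u₁' ∈ N⁺ D v × u₁' ∉ N⁺ D u₁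
                 × (∀ y → y ∈ N⁺ D v → y ∉ N⁺ D u₁ → y ≡ u₁'))
                × (∀ t → t ∈ N⁺ D u₂ ∩ N⁺ D v → Arc D u₁' t)
                × (u₂ ∈ ∁ (N⁺ D v) × N⁺ D u₂ ≢ N⁺ D v)
                × N⁺ D u₂ ∩ N⁺ D v ≡ N⁺ D v - u₁'))
lemma6 n 8≤n D ex v v-full u₁ u₂ _ u₂∈V₂ u₁→u₂ =
  no-arc-between ,
  λ unique-in u₁-full u₂-full → let open BothFull unique-in u₁-full u₂-full in
    ∣N⁺u₁∩V₁∣≡Δ∸1 , u₁′ , u₁′-missed , u₁′→ , (u₂∈V₂ , N⁺u₂≢V₁) , N⁺u₂∩V₁≡V₁-u₁′
  where
  open Extremal D 8≤n ex v v-full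
  open OutsideArc (x∈∁p⇒x∉p u₂∈V₂) u₁→u₂
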